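{- With the Schubert parameters with signs and the signed lengths defined in the context, for all $n\in\mathbb{Z}$ (as elements of $\mathbb{Q}\cup\{\infty\}$, with $1/0=\infty$, $1/\infty=0$, $-\infty=\infty$), \[ M_{a,-n-4}=P_{b,n},\qquad P_{a,-n-4}=-1/M_{b,n},\qquad X_{a,-n-4}=1/X_{b,n}, \] and \[ \bar s_{ -n-4}=\bar c_n,\quad \bar a_{ -n-4}=-\bar a_n,\quad \bar b_{ -n-4}=-\bar b_n,\quad \bar c_{ -n-4}=\bar s_n . \]
   Context: $(S_n)_{n\in\mathbb{Z}}$: $S_{ -2}=\dots=S_2=1$, $S_{n+5}S_n=S_{n+4}S_{n+1}+S_{n+3}S_{n+2}$ for all $n$ (positive integers, $S_{ -n}=S_n$). $(T_n)_{n\in\mathbb{Z}}$: $T_1=1,T_2=-1,T_3=1,T_4=1,T_5=-7$, same recurrence for $n\ge1$, $T_0=0$, $T_{ -n}=-T_n$ (integers, nonzero for $n\neq0$). Put $f_n=S_n/T_n$, $u_n=\frac{S_{n-2}S_{n+1}}{S_{n-1}S_n}$, $v_n=\frac{T_{n-2}T_{n+1}}{T_{n-1}T_n}$, all in $\mathbb{Q}\cup\{\infty\}$. Schubert parameters with signs: $M_{a,n}=-\frac{f_{n+1}f_{n+2}^2}{f_n}$, $P_{a,n}=-\frac{1}{u_{n+2}v_{n+2}}$, $X_{a,n}=2^{(-1)^{n+1}}\frac{f_nf_{n+2}^2}{f_{n+3}}$, $M_{b,n}=u_{n+3}v_{n+3}$, $P_{b,n}=-\frac{f_{n+2}^2f_{n+3}}{f_{n+4}}$,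 $X_{b,n}=2^{(-1)^n}\frac{f_{n+1}}{f_{n+2}^2f_{n+4}}$. Signed lengths: $\bar s_n=-S_{n+3}S_{n+4}^2T_n^2T_{n+1}$, $\bar a_n=-S_{n+2}T_{n+1}T_{n+2}^3T_{n+3}$, $\bar b_n=S_{n+1}S_{n+2}^3S_{n+3}T_{n+2}$, $\bar c_n=S_n^2S_{n+1}T_{n+3}T_{n+4}^2$. -}

module Defs where

open import Data.Nat using (ℕ) renaming (_%_ to _%ℕ_)
open import Data.Integer using (ℤ; +_; -_; _+_; _*_; _<_; _≤_; ∣_∣)
open import Data.Product using (_×_; _,_; proj₁; proj₂)
open import Data.Sum using (_⊎_)
open import Relation.Binary.PropositionalEquality using (_≡_; _≢_)

-- The projective line ℚ ∪ {∞} in homogeneous coordinates.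
-- A pair (p , q) of integers stands for p/q; (p , 0) with p ≠ 0 is ∞.
-- (0 , 0) is not a point; the equality _≃_ below demands that both
-- sides are genuine points, so a degenerate expression (0·∞ etc.) can
-- never be "equal" to anything.

P¹ : Set
P¹ = ℤ × ℤ

IsPoint : P¹ → Set
IsPoint (p , q) = (p ≢ + 0) ⊎ (q ≢ + 0)

infix 4 _≃_
_≃_ : P¹ → P¹ → Set
a ≃ b = IsPoint a × IsPoint b × (proj₁ a * proj₂ b ≡ proj₁ b * proj₂ a)

frac : ℤ → ℤ → P¹
frac p q = (p , q)

infixl 7 _⊗_
_⊗_ : P¹ → P¹ → P¹
(p , q) ⊗ (r , s) = (p * r , q * s)

inv : P¹ → P¹
inv (p , q) = (q , p)

neg : P¹ → P¹
neg (p , q) = (- p , q)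

-- 2^((-1)^k)
twoPow : ℤ → P¹
twoPow k with ∣ k ∣ %ℕ 2
... | ℕ.zero = frac (+ 2) (+ 1)
... | ℕ.suc _ = frac (+ 1) (+ 2)

record IsS (S : ℤ → ℤ) : Set where
  field
    init-2 : S (- + 2) ≡ + 1
    init-1 : S (- + 1) ≡ + 1
    init0  : S (+ 0) ≡ + 1
    init1  : S (+ 1) ≡ + 1
    init2  : S (+ 2) ≡ + 1
    rec    : ∀ n → S (n + + 5) * S n ≡ S (n + + 4) * S (n + + 1) + S (n + + 3) * S (n + + 2)
    sym    : ∀ n → S (- n) ≡ S n
    pos    : ∀ n → + 0 < S n

record IsT (T : ℤ → ℤ) : Set where
  field
    init1 : T (+ 1) ≡ + 1
    init2 : T (+ 2) ≡ - + 1
    init3 : T (+ 3) ≡ + 1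
    init4 : T (+ 4) ≡ + 1
    init5 : T (+ 5) ≡ - + 7
    rec   : ∀ n → + 1 ≤ n → T (n + + 5) * T n ≡ T (n + + 4) * T (n + + 1) + T (n + + 3) * T (n + + 2)
    zero  : T (+ 0) ≡ + 0
    odd   : ∀ n → T (- n) ≡ - T n
    nonzero : ∀ n → n ≢ + 0 → T n ≢ + 0

module _ (S T : ℤ → ℤ) where

  f : ℤ → P¹
  f n = frac (S n) (T n)

  u : ℤ → P¹
  u n = frac (S (n - + 2) * S (n + + 1)) (S (n - + 1) * S n)
    where open Data.Integer using (_-_)

  v : ℤ → P¹
  v n = frac (T (n - + 2) * T (n + + 1)) (T (n - + 1) * T n)
    where open Data.Integer using (_-_)

  Ma : ℤ → P¹
  Ma n = neg (f (n + + 1) ⊗ f (n + + 2) ⊗ f (n + + 2) ⊗ inv (f n))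

  Pa : ℤ → P¹
  Pa n = neg (inv (u (n + + 2) ⊗ v (n + + 2)))

  Xa : ℤ → P¹
  Xa n = twoPow (n + + 1) ⊗ (f n ⊗ f (n + + 2) ⊗ f (n + + 2) ⊗ inv (f (n + + 3)))

  Mb : ℤ → P¹
  Mb n = u (n + + 3) ⊗ v (n + + 3)

  Pb : ℤ → P¹
  Pb n = neg (f (n + + 2) ⊗ f (n + + 2) ⊗ f (n + + 3) ⊗ inv (f (n + + 4)))

  Xb : ℤ → P¹
  Xb n = twoPow n ⊗ (f (n + + 1) ⊗ inv (f (n + + 2) ⊗ f (n + + 2) ⊗ f (n + + 4)))

  sbar : ℤ → ℤ
  sbar n = - (S (n + + 3) * S (n + + 4) * S (n + + 4) * T n * T n * T (n + + 1))

  abar : ℤ → ℤ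
  abar n = - (S (n + + 2) * T (n + + 1) * T (n + + 2) * T (n + + 2) * T (n + + 2) * T (n + + 3))

  bbar : ℤ → ℤ
  bbar n = S (n + + 1) * S (n + + 2) * S (n + + 2) * S (n + + 2) * S (n + + 3) * T (n + + 2)

  cbar : ℤ → ℤ
  cbar n = S n * S n * S (n + + 1) * T (n + + 3) * T (n + + 4) * T (n + + 4)

-- Reflecting indices by n ↦ -n-4 sends n+k to -(n+4-k). Since S is even and T is odd, f is odd
-- (f(-j) = -f(j)) and the cross ratios u, v are symmetric about 1/2 (u(1-j) = u(j)); moreover
-- 2^((-1)^k) only depends on the parity of k. So each left-hand side is, factor by factor, the
-- corresponding right-hand side up to sign. For the identities in ℚ ∪ {∞} one also has to rule
-- out 0·∞, which holds because S never vanishes and T vanishes only at 0.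

module Submission where

open import Defs
open import Data.Integer using (ℤ; +_; -_; _-_; -[1+_]; _+_; _*_; ∣_∣)
open import Data.Integer.Properties
  using (_≟_; ∣-i∣≡∣i∣; +-assoc; *-comm; <⇒≢; neg-injective; i*j≡0⇒i≡0∨j≡0; i-j≡0⇒i≡j)
open import Data.Integer.Tactic.RingSolver using (solve-∀)
open import Data.Nat using (ℕ; zero; suc)
open import Data.Nat.DivMod using (_%_; %-remove-+ˡ)
open import Data.Nat.Divisibility using (∣-refl)
import Data.Nat.Properties as ℕ
open import Data.Product using (_×_; _,_; proj₁; proj₂)
open import Data.Sum using (inj₁; inj₂)
open import Data.Empty using (⊥-elim)
open import Function using (_∘_)
open import Relation.Nullary using (yes; no)
open import Relation.Binary.PropositionalEquality
  using (_≡_; _≢_; refl; sym; trans; cong; cong₂; ≢-sym; module ≡-Reasoning)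

open ≡-Reasoning

infixl 7 _*≢0_
_*≢0_ : ∀ {i j : ℤ} → i ≢ + 0 → j ≢ + 0 → i * j ≢ + 0
_*≢0_ {i} i≢0 j≢0 ij≡0 with i*j≡0⇒i≡0∨j≡0 i ij≡0
... | inj₁ i≡0 = i≢0 i≡0
... | inj₂ j≡0 = j≢0 j≡0

neg-≢0 : ∀ {i : ℤ} → i ≢ + 0 → - i ≢ + 0
neg-≢0 i≢0 = i≢0 ∘ neg-injective

scale : ℤ → P¹ → P¹
scale k (p , q) = (k * p , k * q)

-- Another representative of -x (compare neg): the form f takes at negated indices, T being odd.
neg′ : P¹ → P¹
neg′ (p , q) = (p , - q)

≃-reflexive : ∀ {x y} → IsPoint y → x ≡ y → x ≃ y
≃-reflexive y-pt refl = y-pt , y-pt , refl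

≃-scaled : ∀ {k x y} → k ≢ + 0 → IsPoint y → x ≡ scale k y → x ≃ y
≃-scaled {k} {y = p , q} k≢0 y-pt refl = scaled-pt y-pt , y-pt , cross-multiply k p q
  where
  scaled-pt : IsPoint (p , q) → IsPoint (scale k (p , q))
  scaled-pt (inj₁ p≢0) = inj₁ (k≢0 *≢0 p≢0)
  scaled-pt (inj₂ q≢0) = inj₂ (k≢0 *≢0 q≢0)

  cross-multiply : ∀ k p q → k * p * q ≡ p * (k * q)
  cross-multiply = solve-∀

reflect₀ : ∀ n → - n - + 4 ≡ - (n + + 4)
reflect₀ = solve-∀

reflect-+ : ∀ n k → - n - + 4 + k ≡ - (n + (+ 4 - k))
reflect-+ = solve-∀

reflect₄ : ∀ n → - n - + 4 + + 4 ≡ - n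
reflect₄ = solve-∀

reflect-cross : ∀ n → - n - + 4 + + 2 ≡ + 1 - (n + + 3)
reflect-cross = solve-∀

reflect-involutive : ∀ n → - (- n - + 4) - + 4 ≡ n
reflect-involutive = solve-∀

twoPowByParity : ℕ → P¹
twoPowByParity zero    = frac (+ 2) (+ 1)
twoPowByParity (suc _) = frac (+ 1) (+ 2)

twoPow≡twoPowByParity : ∀ k → twoPow k ≡ twoPowByParity (∣ k ∣ % 2)
twoPow≡twoPowByParity k with ∣ k ∣ % 2
... | zero  = refl
... | suc _ = refl

twoPowByParity-suc : ∀ r → twoPowByParity (suc r % 2) ≡ inv (twoPowByParity (r % 2))
twoPowByParity-suc zero    = refl
twoPowByParity-suc (suc r) =
  trans (cong twoPowByParity (%-remove-+ˡ r ∣-refl)) (cong inv (sym (twoPowByParity-suc r)))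

twoPow-step : ∀ {j k} → ∣ j ∣ ≡ suc ∣ k ∣ → twoPow j ≡ inv (twoPow k)
twoPow-step {j} {k} ∣j∣≡1+∣k∣ = begin
  twoPow j                          ≡⟨ twoPow≡twoPowByParity j ⟩
  twoPowByParity (∣ j ∣ % 2)        ≡⟨ cong (twoPowByParity ∘ (_% 2)) ∣j∣≡1+∣k∣ ⟩
  twoPowByParity (suc ∣ k ∣ % 2)    ≡⟨ twoPowByParity-suc ∣ k ∣ ⟩
  inv (twoPowByParity (∣ k ∣ % 2))  ≡⟨ cong inv (twoPow≡twoPowByParity k) ⟨
  inv (twoPow k)                    ∎

twoPow-+1 : ∀ k → twoPow (k + + 1) ≡ inv (twoPow k)
twoPow-+1 (+ r)          = twoPow-step {+ r + + 1} {+ r} (ℕ.+-comm r 1)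
twoPow-+1 -[1+ zero ]    = refl
twoPow-+1 -[1+ suc r ]   = cong inv (sym (twoPow-step { -[1+ suc r ]} { -[1+ r ]} refl))

twoPow-+2 : ∀ k → twoPow (k + + 2) ≡ twoPow k
twoPow-+2 k = begin
  twoPow (k + + 2)          ≡⟨ cong twoPow (+-assoc k (+ 1) (+ 1)) ⟨
  twoPow (k + + 1 + + 1)    ≡⟨ twoPow-+1 (k + + 1) ⟩
  inv (twoPow (k + + 1))    ≡⟨ cong inv (twoPow-+1 k) ⟩
  twoPow k                  ∎

twoPow-neg : ∀ k → twoPow (- k) ≡ twoPow k
twoPow-neg k = begin
  twoPow (- k)                  ≡⟨ twoPow≡twoPowByParity (- k) ⟩
  twoPowByParity (∣ - k ∣ % 2)  ≡⟨ cong (twoPowByParity ∘ (_% 2)) (∣-i∣≡∣i∣ k) ⟩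
  twoPowByParity (∣ k ∣ % 2)    ≡⟨ twoPow≡twoPowByParity k ⟨
  twoPow k                      ∎

twoPow-nonzero : ∀ k → proj₁ (twoPow k) ≢ + 0 × proj₂ (twoPow k) ≢ + 0
twoPow-nonzero k with ∣ k ∣ % 2
... | zero  = (λ ()) , (λ ())
... | suc _ = (λ ()) , (λ ())

twoPow-reflect : ∀ n → twoPow (- n - + 4 + + 1) ≡ inv (twoPow n)
twoPow-reflect n = begin
  twoPow (- n - + 4 + + 1)   ≡⟨ cong twoPow (reflect-+ n (+ 1)) ⟩
  twoPow (- (n + + 3))       ≡⟨ twoPow-neg (n + + 3) ⟩
  twoPow (n + + 3)           ≡⟨ cong twoPow (+-assoc n (+ 2) (+ 1)) ⟨
  twoPow (n + + 2 + + 1)     ≡⟨ twoPow-+1 (n + + 2) ⟩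
  inv (twoPow (n + + 2))     ≡⟨ cong inv (twoPow-+2 n) ⟩
  inv (twoPow n)             ∎

cross : (ℤ → ℤ) → ℤ → P¹
cross F j = frac (F (j - + 2) * F (j + + 1)) (F (j - + 1) * F j)

cross-symmetric : ∀ (F : ℤ → ℤ) → (∀ a b → F (- a) * F (- b) ≡ F a * F b) →
                  ∀ {i j} → i ≡ + 1 - j → cross F i ≡ cross F j
cross-symmetric F F-pair {j = j} refl =
  cong₂ _,_ (swap (j + + 1) (j - + 2) (idx₁ j) (idx₂ j)) (swap j (j - + 1) (idx₃ j) (idx₄ j))
  where
  swap : ∀ a b {c d} → c ≡ - a → d ≡ - b → F c * F d ≡ F b * F a
  swap a b refl refl = trans (F-pair a b) (*-comm (F a) (F b))

  idx₁ : ∀ j → + 1 - j - + 2 ≡ - (j + + 1)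
  idx₁ = solve-∀
  idx₂ : ∀ j → + 1 - j + + 1 ≡ - (j - + 2)
  idx₂ = solve-∀
  idx₃ : ∀ j → + 1 - j - + 1 ≡ - j
  idx₃ = solve-∀
  idx₄ : ∀ j → + 1 - j ≡ - (j - + 1)
  idx₄ = solve-∀

Ma-formula-reflect : ∀ {a b c x y z} → a ≡ neg′ x → b ≡ neg′ y → c ≡ neg′ z →
                     neg (a ⊗ b ⊗ b ⊗ inv c) ≡ scale (- + 1) (neg (y ⊗ y ⊗ x ⊗ inv z))
Ma-formula-reflect {x = p₁ , q₁} {p₂ , q₂} {p₃ , q₃} refl refl refl =
  cong₂ _,_ (numerator p₁ p₂ q₃) (denominator q₁ q₂ p₃)
  where
  numerator : ∀ p₁ p₂ q₃ → - (p₁ * p₂ * p₂ * - q₃) ≡ - + 1 * - (p₂ * p₂ * p₁ * q₃)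
  numerator = solve-∀
  denominator : ∀ q₁ q₂ p₃ → - q₁ * - q₂ * - q₂ * p₃ ≡ - + 1 * (q₂ * q₂ * q₁ * p₃)
  denominator = solve-∀

Xa-formula-reflect : ∀ {w a b c t x y z} → w ≡ inv t → a ≡ neg′ x → b ≡ neg′ y → c ≡ neg′ z →
                     w ⊗ (a ⊗ b ⊗ b ⊗ inv c) ≡ scale (- + 1) (inv (t ⊗ (z ⊗ inv (y ⊗ y ⊗ x))))
Xa-formula-reflect {t = p , q} {p₁ , q₁} {p₂ , q₂} {p₃ , q₃} refl refl refl refl =
  cong₂ _,_ (numerator q p₁ p₂ q₃) (denominator p q₁ q₂ p₃)
  where
  numerator : ∀ q p₁ p₂ q₃ → q * (p₁ * p₂ * p₂ * - q₃) ≡ - + 1 * (q * (q₃ * (p₂ * p₂ * p₁)))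
  numerator = solve-∀
  denominator : ∀ p q₁ q₂ p₃ → p * (- q₁ * - q₂ * - q₂ * p₃) ≡ - + 1 * (p * (p₃ * (q₂ * q₂ * q₁)))
  denominator = solve-∀

module Reflection {S T : ℤ → ℤ} (isS : IsS S) (isT : IsT T) where

  S-even : ∀ {i j} → i ≡ - j → S i ≡ S j
  S-even {j = j} refl = IsS.sym isS j

  T-odd : ∀ {i j} → i ≡ - j → T i ≡ - T j
  T-odd {j = j} refl = IsT.odd isT j

  S≢0 : ∀ i → S i ≢ + 0
  S≢0 i = ≢-sym (<⇒≢ (IsS.pos isS i))

  T≢0 : ∀ {i} → i ≢ + 0 → T i ≢ + 0
  T≢0 = IsT.nonzero isT _

  T≡0⇒≡0 : ∀ {i} → T i ≡ + 0 → i ≡ + 0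
  T≡0⇒≡0 {i} Ti≡0 with i ≟ + 0
  ... | yes i≡0 = i≡0
  ... | no i≢0  = ⊥-elim (T≢0 i≢0 Ti≡0)

  f-odd : ∀ {i j} → i ≡ - j → f S T i ≡ neg′ (f S T j)
  f-odd i≡-j = cong₂ _,_ (S-even i≡-j) (T-odd i≡-j)

  S-pair : ∀ a b → S (- a) * S (- b) ≡ S a * S b
  S-pair a b = cong₂ _*_ (S-even refl) (S-even refl)

  T-pair : ∀ a b → T (- a) * T (- b) ≡ T a * T b
  T-pair a b = trans (cong₂ _*_ (T-odd refl) (T-odd refl)) (neg*neg (T a) (T b))
    where
    neg*neg : ∀ x y → - x * - y ≡ x * y
    neg*neg = solve-∀

  T≢0-near : ∀ {n c} k → n ≡ c → c + k ≢ + 0 → T (n + k) ≢ + 0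
  T≢0-near k refl = T≢0

  -- A vanishing factor of T pins down the index, so the other factors of T sit at explicit nonzero indices.
  Pb-isPoint : ∀ n → IsPoint (Pb S T n)
  Pb-isPoint n with T (n + + 4) ≟ + 0
  ... | no t₄≢0 = inj₁ (neg-≢0 (S≢0 _ *≢0 S≢0 _ *≢0 S≢0 _ *≢0 t₄≢0))
  ... | yes t₄≡0 = inj₂ (t₂≢0 *≢0 t₂≢0 *≢0 T≢0-near (+ 3) n≡-4 (λ ()) *≢0 S≢0 _)
    where
    n≡-4 : n ≡ - + 4
    n≡-4 = i-j≡0⇒i≡j n (- + 4) (T≡0⇒≡0 t₄≡0)
    t₂≢0 : T (n + + 2) ≢ + 0
    t₂≢0 = T≢0-near (+ 2) n≡-4 (λ ())

  cross-isPoint : ∀ j → IsPoint (neg (inv (cross S j ⊗ cross T j)))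
  cross-isPoint j with T (j - + 1) ≟ + 0 | T j ≟ + 0
  ... | no t≢0 | no t′≢0 = inj₁ (neg-≢0 ((S≢0 _ *≢0 S≢0 _) *≢0 (t≢0 *≢0 t′≢0)))
  ... | yes t≡0 | _ =
    inj₂ ((S≢0 _ *≢0 S≢0 _) *≢0 (T≢0-near (- + 2) j≡1 (λ ()) *≢0 T≢0-near (+ 1) j≡1 (λ ())))
    where
    j≡1 : j ≡ + 1
    j≡1 = i-j≡0⇒i≡j j (+ 1) (T≡0⇒≡0 t≡0)
  ... | no _ | yes t≡0 =
    inj₂ ((S≢0 _ *≢0 S≢0 _) *≢0 (T≢0-near (- + 2) j≡0 (λ ()) *≢0 T≢0-near (+ 1) j≡0 (λ ())))
    where
    j≡0 : j ≡ + 0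
    j≡0 = T≡0⇒≡0 t≡0

  Xb⁻¹-isPoint : ∀ n → IsPoint (inv (Xb S T n))
  Xb⁻¹-isPoint n with T (n + + 1) ≟ + 0
  ... | no t₁≢0 =
    inj₁ (proj₂ (twoPow-nonzero n) *≢0 (t₁≢0 *≢0 (S≢0 _ *≢0 S≢0 _ *≢0 S≢0 _)))
  ... | yes t₁≡0 =
    inj₂ (proj₁ (twoPow-nonzero n) *≢0 (S≢0 _ *≢0 (t₂≢0 *≢0 t₂≢0 *≢0 T≢0-near (+ 4) n≡-1 (λ ()))))
    where
    n≡-1 : n ≡ - + 1
    n≡-1 = i-j≡0⇒i≡j n (- + 1) (T≡0⇒≡0 t₁≡0)
    t₂≢0 : T (n + + 2) ≢ + 0
    t₂≢0 = T≢0-near (+ 2) n≡-1 (λ ())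

  Ma-reflect : ∀ n → Ma S T (- n - + 4) ≃ Pb S T n
  Ma-reflect n = ≃-scaled {k = - + 1} {y = Pb S T n} (λ ()) (Pb-isPoint n)
    (Ma-formula-reflect (f-odd (reflect-+ n (+ 1))) (f-odd (reflect-+ n (+ 2))) (f-odd (reflect₀ n)))

  Pa-reflect : ∀ n → Pa S T (- n - + 4) ≃ neg (inv (Mb S T n))
  Pa-reflect n = ≃-reflexive {y = neg (inv (Mb S T n))} (cross-isPoint (n + + 3))
    (cong₂ (λ x y → neg (inv (x ⊗ y)))
           (cross-symmetric S S-pair (reflect-cross n))
           (cross-symmetric T T-pair (reflect-cross n)))

  Xa-reflect : ∀ n → Xa S T (- n - + 4) ≃ inv (Xb S T n)
  Xa-reflect n = ≃-scaled {k = - + 1} {y = inv (Xb S T n)} (λ ()) (Xb⁻¹-isPoint n)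
    (Xa-formula-reflect (twoPow-reflect n)
       (f-odd (reflect₀ n)) (f-odd (reflect-+ n (+ 2))) (f-odd (reflect-+ n (+ 3))))

  sbar-reflect : ∀ n → sbar S T (- n - + 4) ≡ cbar S T n
  sbar-reflect n
    rewrite S-even (reflect-+ n (+ 3)) | S-even (reflect₄ n)
          | T-odd (reflect₀ n) | T-odd (reflect-+ n (+ 1))
    = identity (S n) (S (n + + 1)) (T (n + + 3)) (T (n + + 4))
    where
    identity : ∀ s₀ s₁ t₃ t₄ → - (s₁ * s₀ * s₀ * - t₄ * - t₄ * - t₃) ≡ s₀ * s₀ * s₁ * t₃ * t₄ * t₄
    identity = solve-∀

  cbar-reflect : ∀ n → cbar S T (- n - + 4) ≡ sbar S T n
  cbar-reflect n = begin
    cbar S T (- n - + 4)              ≡⟨ sbar-reflect (- n - + 4) ⟨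
    sbar S T (- (- n - + 4) - + 4)    ≡⟨ cong (sbar S T) (reflect-involutive n) ⟩
    sbar S T n                        ∎

  abar-reflect : ∀ n → abar S T (- n - + 4) ≡ - abar S T n
  abar-reflect n
    rewrite S-even (reflect-+ n (+ 2))
          | T-odd (reflect-+ n (+ 1)) | T-odd (reflect-+ n (+ 2)) | T-odd (reflect-+ n (+ 3))
    = identity (S (n + + 2)) (T (n + + 1)) (T (n + + 2)) (T (n + + 3))
    where
    identity : ∀ s₂ t₁ t₂ t₃ → - (s₂ * - t₃ * - t₂ * - t₂ * - t₂ * - t₁) ≡ - (- (s₂ * t₁ * t₂ * t₂ * t₂ * t₃))
    identity = solve-∀

  bbar-reflect : ∀ n → bbar S T (- n - + 4) ≡ - bbar S T n
  bbar-reflect n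
    rewrite S-even (reflect-+ n (+ 1)) | S-even (reflect-+ n (+ 2)) | S-even (reflect-+ n (+ 3))
          | T-odd (reflect-+ n (+ 2))
    = identity (S (n + + 1)) (S (n + + 2)) (S (n + + 3)) (T (n + + 2))
    where
    identity : ∀ s₁ s₂ s₃ t₂ → s₃ * s₂ * s₂ * s₂ * s₁ * - t₂ ≡ - (s₁ * s₂ * s₂ * s₂ * s₃ * t₂)
    identity = solve-∀

lemma3p2 : (S T : ℤ → ℤ) → IsS S → IsT T → (n : ℤ) →
    (Ma S T (- n - + 4) ≃ Pb S T n)
    × (Pa S T (- n - + 4) ≃ neg (inv (Mb S T n)))
    × (Xa S T (- n - + 4) ≃ inv (Xb S T n))
    × (sbar S T (- n - + 4) ≡ cbar S T n)
    × (abar S T (- n - + 4) ≡ - abar S T n)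
    × (bbar S T (- n - + 4) ≡ - bbar S T n)
    × (cbar S T (- n - + 4) ≡ sbar S T n)
lemma3p2 S T isS isT n =
  Ma-reflect n , Pa-reflect n , Xa-reflect n ,
  sbar-reflect n , abar-reflect n , bbar-reflect n , cbar-reflect n
  where open Reflection isS isT
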